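{- Let $p$ be a prime, let $\mathcal{X}$ be a subset of $\mathbb{F}_p$ and let $m$ be a positive integer such that $$|m\mathcal{X}|<\min\Big\{33m|\mathcal{X}|,\ \frac{p-1}{8}\Big\}.$$ Assume that $m\mathcal{X}$ is contained in an arithmetic progression in $\mathbb{F}_p$ of at most $2|m\mathcal{X}|$ terms. Then $\mathcal{X}$ is contained in an arithmetic progression in $\mathbb{F}_p$ of at most $132|\mathcal{X}|$ terms.
   Context: $\mathbb{F}_p$ is the field of residues modulo the prime $p$. For a positive integer $m$ and a set $\mathcal{X}\subset\mathbb{F}_p$, $m\mathcal{X}=\{x_1+\cdots+x_m:\ x_i\in\mathcal{X}\}$ denotes the $m$-fold sumset. An arithmetic progression of $L$ terms in $\mathbb{F}_p$ is a set $\{a+jd:\ j=0,1,\ldots,L-1\}$ with $a,d\in\mathbb{F}_p$. -}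

module Defs where

open import Data.Nat using (ℕ; _+_; _*_; _<_; NonZero)
open import Data.Nat.DivMod using (_mod_)
open import Data.Fin using (Fin; toℕ)
open import Data.Fin.Subset using (Subset; _∈_)
open import Data.Vec using (Vec; map)
open import Data.Vec.Relation.Unary.All using (All)
open import Data.Product using (Σ; _×_; ∃-syntax)
open import Relation.Binary.PropositionalEquality using (_≡_)
import Data.Vec as V

sumF : ∀ {p m} .{{_ : NonZero p}} → Vec (Fin p) m → Fin p
sumF {p} v = V.sum (map toℕ v) mod p

InSumset : ∀ {p} .{{_ : NonZero p}} → ℕ → Subset p → Fin p → Set
InSumset {p} m X z = Σ (Vec (Fin p) m) λ v → All (_∈ X) v × sumF v ≡ z

IsSumset : ∀ {p} .{{_ : NonZero p}} → ℕ → Subset p → Subset p → Set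
IsSumset {p} m X S = (z : Fin p) → (z ∈ S → InSumset m X z) × (InSumset m X z → z ∈ S)

apTerm : ∀ {p} .{{_ : NonZero p}} → Fin p → Fin p → ℕ → Fin p
apTerm {p} a d j = (toℕ a + j * toℕ d) mod p

InAP : ∀ {p} .{{_ : NonZero p}} → Fin p → Fin p → ℕ → Fin p → Set
InAP a d L z = ∃[ j ] (j < L × z ≡ apTerm a d j)

InAPAtMost : ∀ {p} .{{_ : NonZero p}} → Subset p → ℕ → Set
InAPAtMost {p} Y B =
  Σ (Fin p) λ a → Σ (Fin p) λ d → Σ ℕ λ L →
    L Data.Nat.≤ B × ((z : Fin p) → z ∈ Y → InAP a d L z)

{-# OPTIONS --safe #-}
-- Fix x₀ ∈ 𝒳. For x ∈ 𝒳 the m + 1 sums σₖ = k x + (m − k) x₀ all lie in m𝒳, hence in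
-- the given progression: σₖ = a + cₖ d with 0 ≤ cₖ < L. As σ moves by the constant step
-- x − x₀, (c₍ₖ₊₁₎ + c₀) d ≡ (cₖ + c₁) d modulo p; for d ≠ 0 and p prime, as both sides of
-- c₍ₖ₊₁₎ + c₀ = cₖ + c₁ are below 2L < p, this holds in ℕ. Thus cₖ = c₀ + k (c₁ − c₀), so
-- m |c₁ − c₀| = |cₘ − c₀| < L ≤ 66 m |𝒳|, and x = x₀ + (c₁ − c₀) d lies in the progression of 132 |𝒳| terms centred at x₀.
module Submission where

open import Defs
open import Data.Nat
  using (ℕ; zero; suc; pred; _+_; _*_; _<_; _≤_; _∸_; _%_; _/_; _≟_; NonZero; z≤n; s≤s)
open import Data.Nat.Properties
open import Data.Nat.DivMod
  using (_mod_; %-distribˡ-+; m%n%n≡m%n; [m+kn]%n≡m%n; m≡m%n+[m/n]*n; m<n⇒m%n≡m)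
open import Data.Nat.Divisibility using (_∣_; divides; >⇒∤)
open import Data.Nat.Primality using (Prime; euclidsLemma)
open import Data.Nat.Tactic.RingSolver using (solve-∀)
open import Data.Fin using (Fin; toℕ)
open import Data.Fin.Properties using (toℕ-fromℕ<; toℕ-injective; toℕ<n)
open import Data.Fin.Subset using (Subset; ∣_∣; _∈_; Nonempty)
open import Data.Fin.Subset.Properties using (nonempty?; Empty-unique; ∣⊥∣≡0)
open import Data.Vec using (Vec; []; _∷_; map; sum)
open import Data.Vec.Relation.Unary.All using (All; []; _∷_)
open import Data.Product using (_×_; _,_; proj₁; proj₂; uncurry)
open import Data.Sum using (inj₁; inj₂)
open import Relation.Binary.PropositionalEquality
open import Relation.Nullary using (yes; no; contradiction)

infix 4 _≡_[mod_]
_≡_[mod_] : ℕ → ℕ → (n : ℕ) → .{{NonZero n}} → Set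
u ≡ v [mod n ] = u % n ≡ v % n

module _ {n : ℕ} .{{_ : NonZero n}} where

  ≡⇒≡-mod : ∀ {u v} → u ≡ v → u ≡ v [mod n ]
  ≡⇒≡-mod = cong (_% n)

  +-≡-mod : ∀ {u u′ v v′} → u ≡ u′ [mod n ] → v ≡ v′ [mod n ] → u + v ≡ u′ + v′ [mod n ]
  +-≡-mod {u} {u′} {v} {v′} e f = begin
    (u + v) % n           ≡⟨ %-distribˡ-+ u v n ⟩
    (u % n + v % n) % n   ≡⟨ cong₂ (λ s t → (s + t) % n) e f ⟩
    (u′ % n + v′ % n) % n ≡⟨ %-distribˡ-+ u′ v′ n ⟨
    (u′ + v′) % n         ∎
    where open ≡-Reasoning

  -- Adding w * pred n turns + w into the multiple + w * n, which vanishes modulo n.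
  +-cancelʳ-≡-mod : ∀ u v w → u + w ≡ v + w [mod n ] → u ≡ v [mod n ]
  +-cancelʳ-≡-mod u v w e = begin
    u % n                     ≡⟨ [m+kn]%n≡m%n u w n ⟨
    (u + w * n) % n           ≡⟨ cong (_% n) (absorb u) ⟨
    (u + w + w * pred n) % n  ≡⟨ +-≡-mod e refl ⟩
    (v + w + w * pred n) % n  ≡⟨ cong (_% n) (absorb v) ⟩
    (v + w * n) % n           ≡⟨ [m+kn]%n≡m%n v w n ⟩
    v % n                     ∎
    where
    open ≡-Reasoning
    regroup : ∀ y w q → y + w + w * q ≡ y + w * suc q
    regroup = solve-∀
    absorb : ∀ y → y + w + w * pred n ≡ y + w * n
    absorb y = trans (regroup y w (pred n)) (cong (λ t → y + w * t) (suc-pred n))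

  ≡-mod-rebase : ∀ {u v u′ v′ a b s t s′ t′} → u + v ≡ u′ + v′ [mod n ] →
    u ≡ a + s [mod n ] → v ≡ b + t [mod n ] → u′ ≡ a + s′ [mod n ] → v′ ≡ b + t′ [mod n ] →
    s + t ≡ s′ + t′ [mod n ]
  ≡-mod-rebase {u} {v} {u′} {v′} {a} {b} {s} {t} {s′} {t′} e f g f′ g′ = +-cancelʳ-≡-mod _ _ (a + b) (begin
    (s + t + (a + b)) % n        ≡⟨ ≡⇒≡-mod (interchange s t a b) ⟩
    (a + s + (b + t)) % n        ≡⟨ +-≡-mod f g ⟨
    (u + v) % n                  ≡⟨ e ⟩
    (u′ + v′) % n                ≡⟨ +-≡-mod f′ g′ ⟩
    (a + s′ + (b + t′)) % n      ≡⟨ ≡⇒≡-mod (interchange s′ t′ a b) ⟨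
    (s′ + t′ + (a + b)) % n      ∎)
    where
    open ≡-Reasoning
    interchange : ∀ s t a b → s + t + (a + b) ≡ a + s + (b + t)
    interchange = solve-∀

  ≡-mod⇒∣∸ : ∀ u v → u ≡ v [mod n ] → n ∣ u ∸ v
  ≡-mod⇒∣∸ u v e = divides (u / n ∸ v / n) (begin
    u ∸ v                                         ≡⟨ cong₂ _∸_ (m≡m%n+[m/n]*n u n) (m≡m%n+[m/n]*n v n) ⟩
    (u % n + (u / n) * n) ∸ (v % n + (v / n) * n) ≡⟨ cong (λ t → (u % n + (u / n) * n) ∸ (t + (v / n) * n)) e ⟨
    (u % n + (u / n) * n) ∸ (u % n + (v / n) * n) ≡⟨ [m+n]∸[m+o]≡n∸o (u % n) _ _ ⟩
    (u / n) * n ∸ (v / n) * n                     ≡⟨ *-distribʳ-∸ n (u / n) (v / n) ⟨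
    (u / n ∸ v / n) * n                           ∎)
    where open ≡-Reasoning

  <∧∣⇒≡0 : ∀ {u} → u < n → n ∣ u → u ≡ 0
  <∧∣⇒≡0 {zero}  _   _   = refl
  <∧∣⇒≡0 {suc u} u<n n∣u = contradiction n∣u (>⇒∤ u<n)

module _ {p : ℕ} .{{_ : NonZero p}} (p-prime : Prime p) {d : ℕ} (0<d : 0 < d) (d<p : d < p) where

  private
    *-cancelʳ-≥-≡-mod : ∀ {u v} → u < p → v ≤ u → u * d ≡ v * d [mod p ] → u ≡ v
    *-cancelʳ-≥-≡-mod {u} {v} u<p v≤u e
      with euclidsLemma (u ∸ v) d p-prime
             (subst (p ∣_) (sym (*-distribʳ-∸ d u v)) (≡-mod⇒∣∸ (u * d) (v * d) e))
    ... | inj₁ p∣u∸v = ≤-antisym (m∸n≡0⇒m≤n (<∧∣⇒≡0 (≤-<-trans (m∸n≤m u v) u<p) p∣u∸v)) v≤u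
    ... | inj₂ p∣d   = contradiction (<∧∣⇒≡0 d<p p∣d) (m<n⇒n≢0 0<d)

  *-cancelʳ-≡-mod : ∀ {u v} → u < p → v < p → u * d ≡ v * d [mod p ] → u ≡ v
  *-cancelʳ-≡-mod {u} {v} u<p v<p e with ≤-total v u
  ... | inj₁ v≤u = *-cancelʳ-≥-≡-mod u<p v≤u e
  ... | inj₂ u≤v = sym (*-cancelʳ-≥-≡-mod v<p u≤v (sym e))

module _ {p : ℕ} .{{_ : NonZero p}} where

  toℕ-mod-≡-mod : ∀ u → toℕ (u mod p) ≡ u [mod p ]
  toℕ-mod-≡-mod u = trans (cong (_% p) (toℕ-fromℕ< _)) (m%n%n≡m%n u p)

  toℕ-≡-mod⇒≡ : ∀ {x y : Fin p} → toℕ x ≡ toℕ y [mod p ] → x ≡ y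
  toℕ-≡-mod⇒≡ {x} {y} e =
    toℕ-injective (trans (sym (m<n⇒m%n≡m (toℕ<n x))) (trans e (m<n⇒m%n≡m (toℕ<n y))))

  apTerm-≡-mod : ∀ a d j → toℕ (apTerm a d j) ≡ toℕ a + j * toℕ d [mod p ]
  apTerm-≡-mod a d j = toℕ-mod-≡-mod (toℕ a + j * toℕ d)

  ≡-mod⇒≡-apTerm : ∀ {z} a d j → toℕ z ≡ toℕ a + j * toℕ d [mod p ] → z ≡ apTerm a d j
  ≡-mod⇒≡-apTerm a d j e = toℕ-≡-mod⇒≡ (trans e (sym (apTerm-≡-mod a d j)))

  -- The point x₀ − K d, written with pred p ≡ −1.
  stepBack : Fin p → ℕ → Fin p → Fin p
  stepBack x₀ K d = apTerm x₀ d (K * pred p)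

  stepBack-+ : ∀ x₀ K d → toℕ (stepBack x₀ K d) + K * toℕ d ≡ toℕ x₀ [mod p ]
  stepBack-+ x₀ K d = begin
    (toℕ (stepBack x₀ K d) + K * toℕ d) % p          ≡⟨ +-≡-mod (apTerm-≡-mod x₀ d (K * pred p)) refl ⟩
    (toℕ x₀ + K * pred p * toℕ d + K * toℕ d) % p    ≡⟨ ≡⇒≡-mod (regroup (toℕ x₀) K (pred p) (toℕ d)) ⟩
    (toℕ x₀ + K * toℕ d * suc (pred p)) % p          ≡⟨ cong (λ t → (toℕ x₀ + K * toℕ d * t) % p) (suc-pred p) ⟩
    (toℕ x₀ + K * toℕ d * p) % p                     ≡⟨ [m+kn]%n≡m%n (toℕ x₀) (K * toℕ d) p ⟩
    toℕ x₀ % p                                       ∎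
    where
    open ≡-Reasoning
    regroup : ∀ x K q d → x + K * q * d + K * d ≡ x + K * d * suc q
    regroup = solve-∀

  InAP-stepBack : ∀ {x x₀ d : Fin p} {K c₀ c₁} →
    c₁ * toℕ d + toℕ x₀ ≡ c₀ * toℕ d + toℕ x [mod p ] → c₁ < K + c₀ → c₀ < K + c₁ →
    InAP (stepBack x₀ K d) d (K + K) x
  InAP-stepBack {x} {x₀} {d} {K} {c₀} {c₁} e c₁<K+c₀ c₀<K+c₁ =
    j , j<K+K , ≡-mod⇒≡-apTerm (stepBack x₀ K d) d j (sym x≡s+jd)
    where
    s = toℕ (stepBack x₀ K d)
    j = K + c₁ ∸ c₀
    j+c₀ : j + c₀ ≡ K + c₁
    j+c₀ = m∸n+n≡m (<⇒≤ c₀<K+c₁)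
    j<K+K : j < K + K
    j<K+K = +-cancelʳ-< c₀ j (K + K)
      (subst₂ _<_ (sym j+c₀) (sym (+-assoc K K c₀)) (+-monoʳ-< K c₁<K+c₀))
    split : ∀ s j c d → s + j * d + c * d ≡ s + (j + c) * d
    split = solve-∀
    regroup : ∀ s K c d → s + (K + c) * d ≡ s + K * d + c * d
    regroup = solve-∀
    x≡s+jd : s + j * toℕ d ≡ toℕ x [mod p ]
    x≡s+jd = +-cancelʳ-≡-mod _ _ (c₀ * toℕ d) (begin
      (s + j * toℕ d + c₀ * toℕ d) % p  ≡⟨ ≡⇒≡-mod (split s j c₀ (toℕ d)) ⟩
      (s + (j + c₀) * toℕ d) % p        ≡⟨ cong (λ t → (s + t * toℕ d) % p) j+c₀ ⟩
      (s + (K + c₁) * toℕ d) % p        ≡⟨ ≡⇒≡-mod (regroup s K c₁ (toℕ d)) ⟩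
      (s + K * toℕ d + c₁ * toℕ d) % p  ≡⟨ +-≡-mod (stepBack-+ x₀ K d) refl ⟩
      (toℕ x₀ + c₁ * toℕ d) % p         ≡⟨ ≡⇒≡-mod (+-comm (toℕ x₀) _) ⟩
      (c₁ * toℕ d + toℕ x₀) % p         ≡⟨ e ⟩
      (c₀ * toℕ d + toℕ x) % p          ≡⟨ ≡⇒≡-mod (+-comm _ (toℕ x)) ⟩
      (toℕ x + c₀ * toℕ d) % p          ∎)
      where open ≡-Reasoning

mix : ∀ {A : Set} → A → A → (n k : ℕ) → Vec A n
mix x y zero    k       = []
mix x y (suc n) zero    = y ∷ mix x y n zero
mix x y (suc n) (suc k) = x ∷ mix x y n k

All-mix : ∀ {A : Set} {P : A → Set} {x y : A} → P x → P y → ∀ n k → All P (mix x y n k)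
All-mix px py zero    k       = []
All-mix px py (suc n) zero    = py ∷ All-mix px py n zero
All-mix px py (suc n) (suc k) = px ∷ All-mix px py n k

sum-map-mix-suc : ∀ {A : Set} (f : A → ℕ) (x y : A) {n k} → k < n →
  sum (map f (mix x y n (suc k))) + f y ≡ sum (map f (mix x y n k)) + f x
sum-map-mix-suc f x y {suc n} {zero}  _         = exchange (f x) (sum (map f (mix x y n zero))) (f y)
  where
  exchange : ∀ a s b → a + s + b ≡ b + s + a
  exchange = solve-∀
sum-map-mix-suc f x y {suc n} {suc k} (s≤s k<n) = begin
  f x + sum (map f (mix x y n (suc k))) + f y    ≡⟨ +-assoc (f x) _ (f y) ⟩
  f x + (sum (map f (mix x y n (suc k))) + f y)  ≡⟨ cong (f x +_) (sum-map-mix-suc f x y k<n) ⟩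
  f x + (sum (map f (mix x y n k)) + f x)        ≡⟨ +-assoc (f x) _ (f x) ⟨
  f x + sum (map f (mix x y n k)) + f x          ∎
  where open ≡-Reasoning

module _ {m : ℕ} (c : ℕ → ℕ) (step : ∀ k → k < m → c (suc k) + c 0 ≡ c k + c 1) where

  constant-step⇒closed-form : ∀ k → k ≤ m → c k + k * c 0 ≡ c 0 + k * c 1
  constant-step⇒closed-form zero    _   = refl
  constant-step⇒closed-form (suc k) k<m = begin
    c (suc k) + (c 0 + k * c 0)  ≡⟨ +-assoc (c (suc k)) (c 0) _ ⟨
    c (suc k) + c 0 + k * c 0    ≡⟨ cong (_+ k * c 0) (step k k<m) ⟩
    c k + c 1 + k * c 0          ≡⟨ swap (c k) (c 1) (k * c 0) ⟩
    c k + k * c 0 + c 1          ≡⟨ cong (_+ c 1) (constant-step⇒closed-form k (<⇒≤ k<m)) ⟩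
    c 0 + k * c 1 + c 1          ≡⟨ swap (c 0) (k * c 1) (c 1) ⟩
    c 0 + c 1 + k * c 1          ≡⟨ +-assoc (c 0) (c 1) _ ⟩
    c 0 + (c 1 + k * c 1)        ∎
    where
    open ≡-Reasoning
    swap : ∀ a b c → a + b + c ≡ a + c + b
    swap = solve-∀

  constant-step⇒small-step : ∀ {L K} → c m < L → c 0 < L → L ≤ m * K → c 1 < K + c 0 × c 0 < K + c 1
  constant-step⇒small-step {L} {K} cₘ<L c₀<L L≤mK =
    *-cancelˡ-< m (c 1) (K + c 0) (begin-strict
      m * c 1              ≤⟨ m≤n+m (m * c 1) (c 0) ⟩
      c 0 + m * c 1        ≡⟨ closed-form ⟨
      c m + m * c 0        <⟨ +-monoˡ-< (m * c 0) cₘ<L ⟩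
      L + m * c 0          ≤⟨ +-monoˡ-≤ (m * c 0) L≤mK ⟩
      m * K + m * c 0      ≡⟨ *-distribˡ-+ m K (c 0) ⟨
      m * (K + c 0)        ∎) ,
    *-cancelˡ-< m (c 0) (K + c 1) (begin-strict
      m * c 0              ≤⟨ m≤n+m (m * c 0) (c m) ⟩
      c m + m * c 0        ≡⟨ closed-form ⟩
      c 0 + m * c 1        <⟨ +-monoˡ-< (m * c 1) c₀<L ⟩
      L + m * c 1          ≤⟨ +-monoˡ-≤ (m * c 1) L≤mK ⟩
      m * K + m * c 1      ≡⟨ *-distribˡ-+ m K (c 1) ⟨
      m * (K + c 1)        ∎)
    where
    open ≤-Reasoning
    closed-form : c m + m * c 0 ≡ c 0 + m * c 1
    closed-form = constant-step⇒closed-form m ≤-refl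

constant-step⇒parallelogram : ∀ {m x y} (σ : ℕ → ℕ) → 0 < m →
  (∀ k → k < m → σ (suc k) + y ≡ σ k + x) → ∀ k → k < m → σ (suc k) + σ 0 ≡ σ k + σ 1
constant-step⇒parallelogram {m} {x} {y} σ 0<m step k k<m =
  +-cancelʳ-≡ (y + x) _ _ (begin
    σ (suc k) + σ 0 + (y + x)  ≡⟨ interchange (σ (suc k)) (σ 0) y x ⟩
    σ (suc k) + y + (σ 0 + x)  ≡⟨ cong₂ _+_ (step k k<m) (sym (step 0 0<m)) ⟩
    σ k + x + (σ 1 + y)        ≡⟨ interchange (σ k) (σ 1) x y ⟨
    σ k + σ 1 + (x + y)        ≡⟨ cong (σ k + σ 1 +_) (+-comm x y) ⟩
    σ k + σ 1 + (y + x)        ∎)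
  where
  open ≡-Reasoning
  interchange : ∀ a b c d → a + b + (c + d) ≡ a + c + (b + d)
  interchange = solve-∀

module _ {p : ℕ} .{{_ : NonZero p}} (p-prime : Prime p) {a d : Fin p} {L m K : ℕ}
         (2L<p : L + L < p) (L≤mK : L ≤ m * K) (0<m : 0 < m) {x x₀ : Fin p} (σ : ℕ → ℕ)
         (step : ∀ k → k < m → σ (suc k) + toℕ x₀ ≡ σ k + toℕ x) where

  private
    module Indices (σ∈AP : ∀ k → InAP a d L (σ k mod p)) where
      c : ℕ → ℕ
      c k = proj₁ (σ∈AP k)
      c<L : ∀ k → c k < L
      c<L k = proj₁ (proj₂ (σ∈AP k))
      σ≡a+cd : ∀ k → σ k ≡ toℕ a + c k * toℕ d [mod p ]
      σ≡a+cd k = trans (sym (toℕ-mod-≡-mod (σ k)))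
        (trans (cong (λ z → toℕ z % p) (proj₂ (proj₂ (σ∈AP k)))) (apTerm-≡-mod a d (c k)))

    InAP-of-indices : (c : ℕ → ℕ) → (∀ k → c k < L) → (∀ k → σ k ≡ toℕ a + c k * toℕ d [mod p ]) →
      (∀ k → k < m → c (suc k) + c 0 ≡ c k + c 1) → InAP (stepBack x₀ K d) d (K + K) x
    InAP-of-indices c c<L σ≡a+cd c-step =
      uncurry (InAP-stepBack x-x₀) (constant-step⇒small-step c c-step (c<L m) (c<L 0) L≤mK)
      where
      x-x₀ : c 1 * toℕ d + toℕ x₀ ≡ c 0 * toℕ d + toℕ x [mod p ]
      x-x₀ = ≡-mod-rebase {a = toℕ a} {b = 0} (≡⇒≡-mod (step 0 0<m)) (σ≡a+cd 1) refl (σ≡a+cd 0) refl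

  InAP-of-steps : (∀ k → InAP a d L (σ k mod p)) → InAP (stepBack x₀ K d) d (K + K) x
  InAP-of-steps σ∈AP with toℕ d ≟ 0
  -- For d = 0 the indices given by σ∈AP need not move by a constant step; all-zero ones do.
  ... | yes d≡0 = InAP-of-indices (λ _ → 0) (λ _ → ≤-<-trans z≤n (c<L 0)) σ≡a+0d (λ _ _ → refl)
    where
    open Indices σ∈AP
    σ≡a+0d : ∀ k → σ k ≡ toℕ a + 0 * toℕ d [mod p ]
    σ≡a+0d k = trans (σ≡a+cd k) (cong (λ t → (toℕ a + t) % p) (trans (cong (c k *_) d≡0) (*-zeroʳ (c k))))
  ... | no d≢0  = InAP-of-indices c c<L σ≡a+cd c-step
    where
    open Indices σ∈AP
    c+c<p : ∀ k l → c k + c l < p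
    c+c<p k l = <-≤-trans (+-mono-< (c<L k) (c<L l)) (<⇒≤ 2L<p)
    c-step : ∀ k → k < m → c (suc k) + c 0 ≡ c k + c 1
    c-step k k<m = *-cancelʳ-≡-mod p-prime (n≢0⇒n>0 d≢0) (toℕ<n d) (c+c<p (suc k) 0) (c+c<p k 1) (begin
      (c (suc k) + c 0) * toℕ d % p             ≡⟨ ≡⇒≡-mod (*-distribʳ-+ (toℕ d) (c (suc k)) (c 0)) ⟩
      (c (suc k) * toℕ d + c 0 * toℕ d) % p     ≡⟨ ≡-mod-rebase {a = toℕ a} {b = toℕ a} parallelogram
                                                     (σ≡a+cd (suc k)) (σ≡a+cd 0) (σ≡a+cd k) (σ≡a+cd 1) ⟩
      (c k * toℕ d + c 1 * toℕ d) % p           ≡⟨ ≡⇒≡-mod (*-distribʳ-+ (toℕ d) (c k) (c 1)) ⟨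
      (c k + c 1) * toℕ d % p                   ∎)
      where
      open ≡-Reasoning
      parallelogram : σ (suc k) + σ 0 ≡ σ k + σ 1 [mod p ]
      parallelogram = ≡⇒≡-mod (constant-step⇒parallelogram σ 0<m step k k<m)

nonempty-if-∣∣>0 : ∀ {n} (X : Subset n) → 0 < ∣ X ∣ → Nonempty X
nonempty-if-∣∣>0 {n} X 0<∣X∣ with nonempty? X
... | yes ne    = ne
... | no  empty = contradiction (trans (cong ∣_∣ (Empty-unique empty)) (∣⊥∣≡0 n)) (m<n⇒n≢0 0<∣X∣)

<*⇒0<ʳ : ∀ {u} b c → u < b * c → 0 < c
<*⇒0<ʳ {u} b zero u<b*0 = contradiction (subst (u <_) (*-zeroʳ b) u<b*0) n≮0
<*⇒0<ʳ b (suc c) _     = s≤s z≤n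

L≤m*66n : ∀ {L s m n} → L ≤ 2 * s → s < 33 * m * n → L ≤ m * (66 * n)
L≤m*66n {L} {s} {m} {n} L≤2s s<33mn = begin
  L                ≤⟨ L≤2s ⟩
  2 * s            ≤⟨ *-monoʳ-≤ 2 (<⇒≤ s<33mn) ⟩
  2 * (33 * m * n) ≡⟨ regroup m n ⟩
  m * (66 * n)     ∎
  where
  open ≤-Reasoning
  regroup : ∀ m n → 2 * (33 * m * n) ≡ m * (66 * n)
  regroup = solve-∀

L+L<p : ∀ {L s p} → L ≤ 2 * s → 8 * s < p ∸ 1 → L + L < p
L+L<p {L} {s} {p} L≤2s 8s<p∸1 = begin-strict
  L + L          ≤⟨ +-mono-≤ L≤2s L≤2s ⟩
  2 * s + 2 * s  ≡⟨ double s ⟩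
  4 * s          ≤⟨ *-monoˡ-≤ s {4} {8} (+-monoʳ-≤ 4 z≤n) ⟩
  8 * s          <⟨ 8s<p∸1 ⟩
  p ∸ 1          ≤⟨ m∸n≤m p 1 ⟩
  p              ∎
  where
  open ≤-Reasoning
  double : ∀ n → 2 * n + 2 * n ≡ 4 * n
  double = solve-∀

lemma4 : (p : ℕ) .{{_ : NonZero p}} → Prime p →
    (X : Subset p) → (m : ℕ) → 0 < m →
    (mX : Subset p) → IsSumset m X mX →
    ∣ mX ∣ < 33 * m * ∣ X ∣ → 8 * ∣ mX ∣ < p ∸ 1 →
    InAPAtMost mX (2 * ∣ mX ∣) →
    InAPAtMost X (132 * ∣ X ∣)
lemma4 p p-prime X m 0<m mX isSumset mX<33m∣X∣ 8mX<p∸1 (a , d , L , L≤2∣mX∣ , mX⊆AP) =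
  centredAt (nonempty-if-∣∣>0 X (<*⇒0<ʳ (33 * m) ∣ X ∣ mX<33m∣X∣))
  where
  K = 66 * ∣ X ∣
  centredAt : Nonempty X → InAPAtMost X (132 * ∣ X ∣)
  centredAt (x₀ , x₀∈X) = stepBack x₀ K d , d , K + K , ≤-reflexive (66+66≡132 ∣ X ∣) , λ x x∈X →
    InAP-of-steps p-prime {K = K} (L+L<p {s = ∣ mX ∣} L≤2∣mX∣ 8mX<p∸1)
      (L≤m*66n {s = ∣ mX ∣} {m = m} {n = ∣ X ∣} L≤2∣mX∣ mX<33m∣X∣) 0<m
      (λ k → sum (map toℕ (mix x x₀ m k)))
      (λ _ k<m → sum-map-mix-suc toℕ x x₀ k<m)
      (λ k → mX⊆AP _ (proj₂ (isSumset _) (mix x x₀ m k , All-mix x∈X x₀∈X m k , refl)))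
    where
    66+66≡132 : ∀ n → 66 * n + 66 * n ≡ 132 * n
    66+66≡132 = solve-∀
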